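{- Let $k,\ell$ be integers with $\min(k,\ell)\ge 2$, and let $(1,a_1,\ldots,a_{(k-1)(\ell-1)})$ be a cyclic permutation of $\{1,\ldots,(k-1)(\ell-1)+1\}$. Then $(1,a_1,\ldots,a_{(k-1)(\ell-1)})\in\mathbb{C}_{k,\ell}$ if and only if $[a_1-1,a_2-1,\ldots,a_{(k-1)(\ell-1)}-1]\in\mathbb{C}^{\star}_{k,\ell}$.
   Context: A cyclic permutation of a finite set of distinct integers is an arrangement of its elements in a circle, written $(j_1,\ldots,j_n)$, up to cyclic rotation. A cyclic sub-permutation is obtained by deleting some elements and keeping the rest in their cyclic order; it is increasing if it can be written $(j_1,\ldots,j_n)$ with $j_1<\cdots<j_n$ and decreasing if it can be written with $j_1>\cdots>j_n$. $\mathbb{C}_{k,\ell}$ is the set of cyclic permutations of $\{1,\ldots,(k-1)(\ell-1)+1\}$ with no increasing cyclic sub-permutation of length $k+1$ and no decreasing cyclic sub-permutation of length $\ell+1$. $\mathbb{S}_{k-1,\ell-1}$ is the set of linear permutations of $\{1,\ldots,(k-1)(\ell-1)\}$ with no increasing subsequence of length $k$ and no decreasing subsequence of length $\ell$. $\mathbb{C}^{\star}_{k,\ell}$ is the set of sequences in $\mathbb{S}_{k-1,\ell-1}$ which, regarded as cyclic permutations (i.e. $[b_1,\ldots,b_n]\mapsto(b_1,\ldots,b_n)$), have no increasing cyclic sub-permutation of length $k+1$ and no decreasing cyclic sub-permutation of length $\ell+1$. -}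

module Defs where

open import Data.Nat using (ℕ; suc; _∸_; _*_; _+_; _<_; _>_)
open import Data.List using (List; []; _∷_; length; map; upTo; drop; take; _++_)
open import Data.List.Relation.Binary.Sublist.Propositional using (_⊆_)
open import Data.List.Relation.Binary.Permutation.Propositional using (_↭_)
open import Data.List.Relation.Unary.Linked using (Linked)
open import Data.Product using (Σ; ∃; _×_)
open import Relation.Binary.PropositionalEquality using (_≡_)
open import Relation.Nullary using (¬_)

-- A cyclic permutation is represented by a list (j₁,…,jₙ); all notions
-- below are invariant under rotation of that list.

rotate : ℕ → List ℕ → List ℕ
rotate i xs = drop i xs ++ take i xs

oneTo : ℕ → List ℕ
oneTo n = map suc (upTo n)

CycIncreasing : List ℕ → Set
CycIncreasing ys = ∃ λ i → Linked _<_ (rotate i ys)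

CycDecreasing : List ℕ → Set
CycDecreasing ys = ∃ λ i → Linked _>_ (rotate i ys)

HasIncCycSub : ℕ → List ℕ → Set
HasIncCycSub n xs = ∃ λ ys → ys ⊆ xs × length ys ≡ n × CycIncreasing ys

HasDecCycSub : ℕ → List ℕ → Set
HasDecCycSub n xs = ∃ λ ys → ys ⊆ xs × length ys ≡ n × CycDecreasing ys

HasIncSub : ℕ → List ℕ → Set
HasIncSub n xs = ∃ λ ys → ys ⊆ xs × length ys ≡ n × Linked _<_ ys

HasDecSub : ℕ → List ℕ → Set
HasDecSub n xs = ∃ λ ys → ys ⊆ xs × length ys ≡ n × Linked _>_ ys

InC : ℕ → ℕ → List ℕ → Set
InC k ℓ xs = (xs ↭ oneTo ((k ∸ 1) * (ℓ ∸ 1) + 1))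
           × ¬ HasIncCycSub (suc k) xs × ¬ HasDecCycSub (suc ℓ) xs

-- 𝕊_{k-1,ℓ-1}: permutations of {1,…,(k-1)(ℓ-1)} with no increasing subsequence
-- of length k and no decreasing subsequence of length ℓ
InS : ℕ → ℕ → List ℕ → Set
InS k ℓ bs = (bs ↭ oneTo ((k ∸ 1) * (ℓ ∸ 1)))
           × ¬ HasIncSub k bs × ¬ HasDecSub ℓ bs

InCstar : ℕ → ℕ → List ℕ → Set
InCstar k ℓ bs = InS k ℓ bs × ¬ HasIncCycSub (suc k) bs × ¬ HasDecCycSub (suc ℓ) bs

module Submission where

-- Write b = [a₁-1,…,aₙ-1].  Since 1 is the smallest entry of the
-- cyclic permutation (1,a₁,…,aₙ), every aᵢ is ≥ 2, so x ↦ x - 1 is an order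
-- embedding on the entries of a and b is a permutation of {1,…,n}.  Hence
-- monotone (cyclic) patterns of b and of a correspond exactly.  The extra
-- entry 1 of (1,a) relates the two notions: an increasing subsequence of a
-- becomes a cyclic increasing pattern once 1 is put in front, a decreasing one
-- once 1 is put at the end; conversely a cyclic monotone pattern of (1,a)
-- either avoids 1 (and is a cyclic pattern of a) or passes through 1, in which
-- case the remaining entries are linearly monotone.  Forbidding the length
-- k+1 / ℓ+1 cyclic patterns in (1,a) is therefore the same as forbidding
-- increasing/decreasing subsequences of length k / ℓ and cyclic patterns of
-- length k+1 / ℓ+1 in b.

open import Defs
open import Data.Nat using (ℕ; _≤_; _∸_; _*_; _+_; suc; zero; _<_; _>_; s≤s; z≤n)
open import Data.Nat.Properties using (+-comm; <-trans; <-asym; <⇒≤)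
open import Data.List using (List; []; _∷_; length; map; _++_; drop; take)
open import Data.List.Properties
  using (map-++; take++drop≡id; ++-identityʳ; drop-map; take-map; length-map; map-applyUpTo; map-∘; map-id)
open import Data.List.Relation.Binary.Permutation.Propositional using (_↭_)
open import Data.List.Relation.Binary.Permutation.Propositional.Properties using (∈-resp-↭; drop-∷)
import Data.List.Relation.Binary.Permutation.Propositional.Properties as Perm
open import Data.List.Relation.Binary.Sublist.Propositional using (_⊆_; []; _∷_; _∷ʳ_)
open import Data.List.Relation.Binary.Sublist.Propositional.Properties using (All-resp-⊆)
import Data.List.Relation.Binary.Sublist.Propositional.Properties as Sublist
open import Data.List.Relation.Unary.Linked using (Linked; []; [-]; _∷_)
import Data.List.Relation.Unary.Linked as Linked
import Data.List.Relation.Unary.Linked.Properties as Linked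
open import Data.List.Relation.Unary.All using (All; []; _∷_)
import Data.List.Relation.Unary.All as All
import Data.List.Relation.Unary.All.Properties as All
open import Data.List.Membership.Propositional using (_∈_)
open import Data.List.Membership.Propositional.Properties using (∈-map⁻)
open import Data.Empty using (⊥-elim)
open import Data.Product using (∃; _×_; _,_)
open import Data.Sum using (_⊎_; inj₁; inj₂; [_,_])
open import Relation.Binary.PropositionalEquality using (_≡_; refl; sym; trans; cong; subst)
open import Function using (_∘_)
open import Function.Bundles using (_⇔_; mk⇔)

-- The pattern predicates of
-- Defs are instances of these, definitionally.

SubWith : (List ℕ → Set) → ℕ → List ℕ → Set
SubWith P n xs = ∃ λ ys → ys ⊆ xs × length ys ≡ n × P ys

Cyclic : (ℕ → ℕ → Set) → List ℕ → Set
Cyclic R ys = ∃ λ i → Linked R (rotate i ys)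

⊆-map⁻ : ∀ (f : ℕ → ℕ) {ys} xs → ys ⊆ map f xs → ∃ λ zs → zs ⊆ xs × map f zs ≡ ys
⊆-map⁻ f []       []         = [] , [] , refl
⊆-map⁻ f (x ∷ xs) (_ ∷ʳ sub) with ⊆-map⁻ f xs sub
... | zs , zs⊆xs , eq = zs , x ∷ʳ zs⊆xs , eq
⊆-map⁻ f (x ∷ xs) (refl ∷ sub) with ⊆-map⁻ f xs sub
... | zs , zs⊆xs , eq = x ∷ zs , refl ∷ zs⊆xs , cong (f x ∷_) eq

subWith-map⁺ : ∀ {P Q : List ℕ → Set} {n} (f : ℕ → ℕ) xs →
  (∀ {zs} → zs ⊆ xs → P zs → Q (map f zs)) → SubWith P n xs → SubWith Q n (map f xs)
subWith-map⁺ f xs transfer (zs , zs⊆xs , refl , pz) =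
  map f zs , Sublist.map⁺ f zs⊆xs , length-map f zs , transfer zs⊆xs pz

subWith-map⁻ : ∀ {P Q : List ℕ → Set} {n} (f : ℕ → ℕ) xs →
  (∀ {zs} → zs ⊆ xs → Q (map f zs) → P zs) → SubWith Q n (map f xs) → SubWith P n xs
subWith-map⁻ f xs transfer (ys , ys⊆fxs , refl , qy) with ⊆-map⁻ f xs ys⊆fxs
... | zs , zs⊆xs , refl = zs , zs⊆xs , sym (length-map f zs) , transfer zs⊆xs qy

subWith-skip : ∀ {P : List ℕ → Set} {n} x {xs} → SubWith P n xs → SubWith P n (x ∷ xs)
subWith-skip x (ys , ys⊆xs , len , py) = ys , x ∷ʳ ys⊆xs , len , py

subWith-head : ∀ {P : List ℕ → Set} {n} x {xs} →
  SubWith (P ∘ (x ∷_)) n xs → SubWith P (suc n) (x ∷ xs)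
subWith-head x (zs , zs⊆xs , len , pz) = x ∷ zs , refl ∷ zs⊆xs , cong suc len , pz

subWith-∷⁻ : ∀ {P : List ℕ → Set} {n} x {xs} →
  SubWith P (suc n) (x ∷ xs) → SubWith P (suc n) xs ⊎ SubWith (P ∘ (x ∷_)) n xs
subWith-∷⁻ x (ys , _ ∷ʳ ys⊆xs , len , py)          = inj₁ (ys , ys⊆xs , len , py)
subWith-∷⁻ x (_ ∷ zs , refl ∷ zs⊆xs , len , pz) = inj₂ (zs , zs⊆xs , cong (_∸ 1) len , pz)

rotate-map : ∀ (f : ℕ → ℕ) i xs → rotate i (map f xs) ≡ map f (rotate i xs)
rotate-map f i xs rewrite drop-map {f = f} i xs | take-map {f = f} i xs =
  sym (map-++ f (drop i xs) (take i xs))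

All-rotate : ∀ {P : ℕ → Set} i {xs} → All P xs → All P (rotate i xs)
All-rotate i pxs = All.++⁺ (All.drop⁺ i pxs) (All.take⁺ i pxs)

lower : ℕ → ℕ
lower x = x ∸ 1

lower-<⁻ : ∀ {x y} → lower x < lower y → x < y
lower-<⁻ {zero}  {suc (suc y)} _  = s≤s z≤n
lower-<⁻ {suc x} {suc y}       lt = s≤s lt

lower-<⁺ : ∀ {x y} → 1 ≤ x → x < y → lower x < lower y
lower-<⁺ {suc x} {suc y} _ (s≤s lt) = lt

module LowerTransfer (R : ℕ → ℕ → Set)
  (reflects : ∀ {x y} → R (lower x) (lower y) → R x y)
  (preserves : ∀ {x y} → 1 ≤ x → 1 ≤ y → R x y → R (lower x) (lower y)) where

  linked⁻ : ∀ {xs} → Linked R (map lower xs) → Linked R xs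
  linked⁻ = Linked.map reflects ∘ Linked.map⁻

  linked⁺ : ∀ {xs} → All (1 ≤_) xs → Linked R xs → Linked R (map lower xs)
  linked⁺ _                 []          = []
  linked⁺ _                 [-]         = [-]
  linked⁺ (px ∷ pxs@(py ∷ _)) (rxy ∷ rs) = preserves px py rxy ∷ linked⁺ pxs rs

  cyclic⁻ : ∀ xs → Cyclic R (map lower xs) → Cyclic R xs
  cyclic⁻ xs (i , lk) = i , linked⁻ (subst (Linked R) (rotate-map lower i xs) lk)

  cyclic⁺ : ∀ xs → All (1 ≤_) xs → Cyclic R xs → Cyclic R (map lower xs)
  cyclic⁺ xs pos (i , lk) =
    i , subst (Linked R) (sym (rotate-map lower i xs)) (linked⁺ (All-rotate i pos) lk)

module Inc = LowerTransfer _<_ lower-<⁻ (λ px _ → lower-<⁺ px)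
module Dec = LowerTransfer _>_ lower-<⁻ (λ _ py → lower-<⁺ py)

linked-++⁻ˡ : ∀ {R : ℕ → ℕ → Set} xs {ys} → Linked R (xs ++ ys) → Linked R xs
linked-++⁻ˡ []           _          = []
linked-++⁻ˡ (x ∷ [])     _          = [-]
linked-++⁻ˡ (x ∷ y ∷ xs) (rxy ∷ rs) = rxy ∷ linked-++⁻ˡ (y ∷ xs) rs

linked-++⁻ʳ : ∀ {R : ℕ → ℕ → Set} xs {ys} → Linked R (xs ++ ys) → Linked R ys
linked-++⁻ʳ []       lk = lk
linked-++⁻ʳ (x ∷ xs) lk = linked-++⁻ʳ xs (Linked.tail lk)

head-below : ∀ u us m ms → Linked _<_ (u ∷ us ++ m ∷ ms) → u < m
head-below u []       m ms (lt ∷ _)  = lt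
head-below u (v ∷ us) m ms (lt ∷ lk) = <-trans lt (head-below v us m ms lk)

min-∷-increasing : ∀ {m zs} → All (m <_) zs → Linked _<_ zs → Linked _<_ (m ∷ zs)
min-∷-increasing []         _  = [-]
min-∷-increasing (m<z ∷ _) lk = m<z ∷ lk

min-snoc-decreasing : ∀ {m zs} → All (m <_) zs → Linked _>_ zs → Linked _>_ (zs ++ m ∷ [])
min-snoc-decreasing []               _          = [-]
min-snoc-decreasing (m<z ∷ [])       [-]        = m<z ∷ [-]
min-snoc-decreasing (_ ∷ m<zs@(_ ∷ _)) (gt ∷ lk) = gt ∷ min-snoc-decreasing m<zs lk

-- The rotation of m ∷ zs by j+1 is (drop j zs) ++ m ∷ (take j zs); if it is
-- increasing, nothing precedes m, so it is m ∷ zs.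
cyclic-increasing-min : ∀ {m} zs → All (m <_) zs → Cyclic _<_ (m ∷ zs) → Linked _<_ zs
cyclic-increasing-min zs _ (zero , lk) = subst (Linked _<_) (++-identityʳ zs) (Linked.tail lk)
cyclic-increasing-min {m} zs m<zs (suc j , lk) with drop j zs in dropEq | All.drop⁺ j m<zs
... | [] | _ = subst (Linked _<_) takeAll (Linked.tail lk)
  where
  takeAll : take j zs ≡ zs
  takeAll = trans (sym (++-identityʳ (take j zs)))
                  (trans (cong (take j zs ++_) (sym dropEq)) (take++drop≡id j zs))
... | u ∷ us | m<u ∷ _ = ⊥-elim (<-asym m<u (head-below u us m (take j zs) lk))

-- Dually, if it is decreasing, nothing follows m, so it is zs ++ [m].
cyclic-decreasing-min : ∀ {m} zs → All (m <_) zs → Cyclic _>_ (m ∷ zs) → Linked _>_ zs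
cyclic-decreasing-min []       _           _            = []
cyclic-decreasing-min (z ∷ zs) (m<z ∷ _)   (zero , gt ∷ _) = ⊥-elim (<-asym m<z gt)
cyclic-decreasing-min zs m<zs (suc j , lk) with take j zs in takeEq | All.take⁺ j m<zs
... | [] | _ = subst (Linked _>_) dropAll (linked-++⁻ˡ (drop j zs) lk)
  where
  dropAll : drop j zs ≡ zs
  dropAll = trans (cong (_++ drop j zs) (sym takeEq)) (take++drop≡id j zs)
... | w ∷ ws | m<w ∷ _ with linked-++⁻ʳ (drop j zs) lk
...   | w<m ∷ _ = ⊥-elim (<-asym m<w w<m)

oneTo-suc : ∀ n → oneTo (suc n) ≡ 1 ∷ map suc (oneTo n)
oneTo-suc n = cong (1 ∷_) (cong (map suc) (sym (map-applyUpTo (λ x → x) suc n)))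

lower-suc : ∀ xs → map lower (map suc xs) ≡ xs
lower-suc xs = trans (sym (map-∘ xs)) (map-id xs)

shifted-above-1 : ∀ n {x} → x ∈ map suc (oneTo n) → 1 < x
shifted-above-1 n x∈ with ∈-map⁻ suc x∈
... | y , y∈ , refl with ∈-map⁻ suc y∈
...   | _ , _ , refl = s≤s (s≤s z≤n)

module _ {n a} (perm : (1 ∷ a) ↭ oneTo (n + 1)) where

  private
    a↭shift : a ↭ map suc (oneTo n)
    a↭shift = drop-∷ (subst ((1 ∷ a) ↭_) (trans (cong oneTo (+-comm n 1)) (oneTo-suc n)) perm)

  entries-above-1 : All (1 <_) a
  entries-above-1 = All.tabulate (shifted-above-1 n ∘ ∈-resp-↭ a↭shift)

  lowered-permutation : map lower a ↭ oneTo n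
  lowered-permutation = subst (map lower a ↭_) (lower-suc (oneTo n)) (Perm.map⁺ lower a↭shift)

module Correspondence {a} (a>1 : All (1 <_) a) where

  private
    b = map lower a

    above-1 : ∀ {zs} → zs ⊆ a → All (1 <_) zs
    above-1 zs⊆a = All-resp-⊆ zs⊆a a>1

    positive : ∀ {zs} → zs ⊆ a → All (1 ≤_) zs
    positive = All.map <⇒≤ ∘ above-1

  inc-sub⇒ : ∀ {n} → HasIncSub n b → HasIncCycSub (suc n) (1 ∷ a)
  inc-sub⇒ = subWith-head 1 ∘ subWith-map⁻ lower a λ {zs} zs⊆a lk →
    0 , subst (Linked _<_) (sym (++-identityʳ (1 ∷ zs)))
              (min-∷-increasing (above-1 zs⊆a) (Inc.linked⁻ lk))

  dec-sub⇒ : ∀ {n} → HasDecSub n b → HasDecCycSub (suc n) (1 ∷ a)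
  dec-sub⇒ = subWith-head 1 ∘ subWith-map⁻ lower a λ zs⊆a lk →
    1 , min-snoc-decreasing (above-1 zs⊆a) (Dec.linked⁻ lk)

  inc-cyc⇒ : ∀ {n} → HasIncCycSub n b → HasIncCycSub n (1 ∷ a)
  inc-cyc⇒ = subWith-skip 1 ∘ subWith-map⁻ lower a λ {zs} _ → Inc.cyclic⁻ zs

  dec-cyc⇒ : ∀ {n} → HasDecCycSub n b → HasDecCycSub n (1 ∷ a)
  dec-cyc⇒ = subWith-skip 1 ∘ subWith-map⁻ lower a λ {zs} _ → Dec.cyclic⁻ zs

  inc-cyc⇐ : ∀ {n} → HasIncCycSub (suc n) (1 ∷ a) → HasIncCycSub (suc n) b ⊎ HasIncSub n b
  inc-cyc⇐ pat with subWith-∷⁻ 1 pat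
  ... | inj₁ avoid = inj₁ (subWith-map⁺ lower a (λ {zs} zs⊆a → Inc.cyclic⁺ zs (positive zs⊆a)) avoid)
  ... | inj₂ through = inj₂ (subWith-map⁺ lower a (λ {zs} zs⊆a cyc →
          Inc.linked⁺ (positive zs⊆a) (cyclic-increasing-min zs (above-1 zs⊆a) cyc)) through)

  dec-cyc⇐ : ∀ {n} → HasDecCycSub (suc n) (1 ∷ a) → HasDecCycSub (suc n) b ⊎ HasDecSub n b
  dec-cyc⇐ pat with subWith-∷⁻ 1 pat
  ... | inj₁ avoid = inj₁ (subWith-map⁺ lower a (λ {zs} zs⊆a → Dec.cyclic⁺ zs (positive zs⊆a)) avoid)
  ... | inj₂ through = inj₂ (subWith-map⁺ lower a (λ {zs} zs⊆a cyc →
          Dec.linked⁺ (positive zs⊆a) (cyclic-decreasing-min zs (above-1 zs⊆a) cyc)) through)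

lemma5 : (k ℓ : ℕ) → 2 ≤ k → 2 ≤ ℓ → (a : List ℕ) →
    length a ≡ (k ∸ 1) * (ℓ ∸ 1) →
    (1 ∷ a) ↭ oneTo ((k ∸ 1) * (ℓ ∸ 1) + 1) →
    InC k ℓ (1 ∷ a) ⇔ InCstar k ℓ (map (λ x → x ∸ 1) a)
lemma5 k ℓ _ _ a _ perm = mk⇔ toCstar toC
  where
  open Correspondence (entries-above-1 perm)

  toCstar : InC k ℓ (1 ∷ a) → InCstar k ℓ (map lower a)
  toCstar (_ , noInc , noDec) =
    (lowered-permutation perm , noInc ∘ inc-sub⇒ , noDec ∘ dec-sub⇒) ,
    noInc ∘ inc-cyc⇒ , noDec ∘ dec-cyc⇒

  toC : InCstar k ℓ (map lower a) → InC k ℓ (1 ∷ a)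
  toC ((_ , noIncSub , noDecSub) , noIncCyc , noDecCyc) =
    perm , [ noIncCyc , noIncSub ] ∘ inc-cyc⇐ , [ noDecCyc , noDecSub ] ∘ dec-cyc⇐
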